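{- Let $S$ be a finite sphere-like poset of rank $k\geq 2$. Suppose that for every $z\in S$ with $\operatorname{rk}(z)=k-2$, the number of elements of $S$ that cover $z$ is even. Then the maximum ranked elements of $S$ admit a proper $2$-colouring: there is a function $\psi:S_k\to\mathbb{Z}_2$, where $S_k=\{x\in S:\operatorname{rk}(x)=k\}$, such that $\psi(x_1)\neq\psi(x_2)$ whenever $x_1,x_2\in S_k$ are adjacent.
   Context: A ranked poset is a poset $S$ with a function $\operatorname{rk}:S\to\mathbb{N}\cup\{0\}$ such that $x<y$ implies $\operatorname{rk}(x)<\operatorname{rk}(y)$ and $x\lessdot y$ ($y$ covers $x$, i.e. $x<y$ with no $z$ satisfying $x<z<y$) implies $\operatorname{rk}(y)=\operatorname{rk}(x)+1$; elements covering nothing have rank $0$. The rank of $S$ is $\max\{\operatorname{rk}(x):x\in S\}$. For $x\in S$, $\Delta(x)=\{z: z\lessdot x\}$ and $\nabla(x)=\{y: x\lessdot y\}$. Two elements $x_1,x_2$ of the same rank are adjacent if $\Delta(x_1)\cap\Delta(x_2)\neq\emptyset$. A matching on $S$ is a set $\mathcal{M}$ of ordered pairs $(x,y)$ with $x\lessdot y$, each element of $S$ lying in at most one pair. An $\mathcal{M}$-path is a sequence $y_0,x_1,y_1,\ldots,x_r,y_r$ ($r\geq 0$) with $(x_i,y_i)\in\mathcal{M}$ and $x_i\lessdot y_{i-1}$, $y_{i-1}\neq y_i$ for each $i$. $\mathcal{M}$ is acyclic if there is no $\mathcal{M}$-path with $r>0$ and $y_r=y_0$ (equivalently, reversing the matched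 edges in the directed Hasse diagram leaves it acyclic). An element is $\mathcal{M}$-critical if it lies in no pair of $\mathcal{M}$. A ranked poset $S$ of rank $k\geq 2$ is sphere-like if: (i) each element of rank $k-1$ is covered by exactly two elements; (ii) for each $y$ of rank $k$ and $z$ of rank $k-2$, the number of $x$ of rank $k-1$ with $z\lessdot x\lessdot y$ is even; (iii) there exists an acyclic matching $\mathcal{M}$ on $S$ such that no element of rank $k-1$ is $\mathcal{M}$-critical. -}

module Defs where

open import Level using (0ℓ)
open import Data.Nat using (ℕ; zero; suc; _+_; _∸_; _≤_)
open import Data.Nat.Divisibility using (_∣_)
open import Data.Fin using (Fin; zero; suc)
open import Data.Fin.Properties using (all?)
open import Data.Product using (Σ; Σ-syntax; ∃; ∃-syntax; _×_; _,_)
open import Data.Empty using (⊥)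
open import Relation.Nullary using (¬_; Dec; yes; no; _×-dec_; ¬?)
open import Relation.Binary.PropositionalEquality using (_≡_; _≢_)
open import Relation.Binary.Structures using (IsDecPartialOrder)
open import Relation.Binary.Construct.Closure.Transitive using (TransClosure)

record FinPoset : Set₁ where
  field
    n     : ℕ
    _≼_   : Fin n → Fin n → Set
    isDPO : IsDecPartialOrder _≡_ _≼_

  open IsDecPartialOrder isDPO public using (_≤?_; _≟_)

  _≺_ : Fin n → Fin n → Set
  x ≺ y = x ≼ y × ¬ (x ≡ y)

  _≺?_ : (x y : Fin n) → Dec (x ≺ y)
  x ≺? y = (x ≤? y) ×-dec ¬? (x ≟ y)

  _⋖_ : Fin n → Fin n → Set
  x ⋖ y = x ≺ y × (∀ z → ¬ (x ≺ z × z ≺ y))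

  _⋖?_ : (x y : Fin n) → Dec (x ⋖ y)
  x ⋖? y = (x ≺? y) ×-dec all? (λ z → ¬? ((x ≺? z) ×-dec (z ≺? y)))

count : ∀ {m} {P : Fin m → Set} → (∀ i → Dec (P i)) → ℕ
count {zero}  P? = 0
count {suc m} P? with P? zero
... | yes _ = suc (count (λ i → P? (suc i)))
... | no  _ = count (λ i → P? (suc i))

Even : ℕ → Set
Even m = 2 ∣ m

module _ (S : FinPoset) where
  open FinPoset S

  record IsRankFunction (rk : Fin n → ℕ) : Set where
    field
      strictMono : ∀ {x y} → x ≺ y → rk x Data.Nat.< rk y
      coverStep  : ∀ {x y} → x ⋖ y → rk y ≡ suc (rk x)
      minimal0   : ∀ x → (∀ z → ¬ (z ⋖ x)) → rk x ≡ 0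

  HasRank : (rk : Fin n → ℕ) → ℕ → Set
  HasRank rk k = (∃[ x ] rk x ≡ k) × (∀ x → rk x ≤ k)

  record IsMatching (M : Fin n → Fin n → Set) : Set where
    field
      covers : ∀ {x y} → M x y → x ⋖ y
      uniq-bot : ∀ {x y y'} → M x y → M x y' → y ≡ y'
      uniq-top : ∀ {x x' y} → M x y → M x' y → x ≡ x'
      disjoint : ∀ {x y z} → M x y → ¬ M y z

  MStep : (M : Fin n → Fin n → Set) → Fin n → Fin n → Set
  MStep M y y' = Σ[ x ∈ Fin n ] (M x y' × x ⋖ y × ¬ (y ≡ y'))

  Acyclic : (M : Fin n → Fin n → Set) → Set
  Acyclic M = ∀ y → ¬ TransClosure (MStep M) y y

  Critical : (M : Fin n → Fin n → Set) → Fin n → Set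
  Critical M x = ¬ (∃[ y ] M x y) × ¬ (∃[ z ] M z x)

  between : (rk : Fin n → ℕ) (k : ℕ) → Fin n → Fin n → ℕ
  between rk k z y =
    count (λ x → (rk x Data.Nat.≟ (k ∸ 1)) ×-dec ((z ⋖? x) ×-dec (x ⋖? y)))

  upDegree : Fin n → ℕ
  upDegree x = count (λ y → x ⋖? y)

  record SphereLike (rk : Fin n → ℕ) (k : ℕ) : Set₁ where
    field
      ranked  : IsRankFunction rk
      rank-k  : HasRank rk k
      k≥2     : 2 ≤ k
      cond-i  : ∀ x → rk x ≡ k ∸ 1 → upDegree x ≡ 2
      cond-ii : ∀ y z → rk y ≡ k → rk z ≡ k ∸ 2 → Even (between rk k z y)
      cond-iii : ∃[ M ] (IsMatching M × Acyclic M
                          × (∀ x → rk x ≡ k ∸ 1 → ¬ Critical M x))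

  Adjacent : Fin n → Fin n → Set
  Adjacent x₁ x₂ = ¬ (x₁ ≡ x₂) × (∃[ z ] (z ⋖ x₁ × z ⋖ x₂))

{-# OPTIONS --safe #-}

-- Work over 𝔽₂ = Parity with the boundary (∂ g) x = Σ_{x ⋖ y} g y.  Condition (ii) says
-- ∂ ∘ ∂ = 0 from rank k to rank k - 2, and even up-degrees at rank k - 2 say that the
-- all-ones chain on rank k - 1 is a cycle.  If ψ on rank k has ∂ ψ = 1 on rank k - 1, then,
-- an element z of rank k - 1 having exactly two covers x₁ and x₂, ψ x₁ + ψ x₂ = 1: so ψ is a
-- proper colouring.  Such a ψ exists because the acyclic matching kills homology in rank
-- k - 1: define ψ t, for t matched with f below it, so that ∂ ψ f = 1, by recursion along the
-- matching.  An element f of rank k - 1 with ∂ ψ f ≠ 1 is then matched with some r below it,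
-- and since ∂ (1 + ∂ ψ) r = 0 some other f′ ⋗ r also has ∂ ψ f′ ≠ 1, which is a step
-- f′ → f of an M-path.  Repeating this produces a cycle, contradicting acyclicity.

module Submission where

open import Defs
open import Algebra.Bundles using (CommutativeSemiring)
open import Data.Bool.Base using (if_then_else_)
open import Data.Bool.Properties using (∧-identityʳ)
open import Data.Nat.Base using (ℕ; zero; suc; _∸_; s≤s; parity)
open import Data.Nat.Divisibility using (divides)
open import Data.Nat.Properties using (n<1+n; suc-injective) renaming (_≟_ to _≟ℕ_)
open import Data.Fin.Base using (Fin; zero; suc; _<_)
open import Data.Fin.Properties using (_≟_; any?; all?; pigeonhole; ∀-cons)
open import Data.Parity.Base using (Parity; 0ℙ; 1ℙ)
open import Data.Parity.Properties
  using ( +-*-semiring; +-*-commutativeSemiring; +-commutativeSemigroup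
        ; +-homo-+; *-homo-*; +-cancelˡ-≡; p+p≡0ℙ; p≢p⁻¹)
  renaming (_≟_ to _≟ℙ_)
open CommutativeSemiring +-*-commutativeSemiring
  using (_+_; _*_; zeroʳ; *-identityʳ; +-identityʳ; +-assoc; *-assoc; distribˡ)
open import Algebra.Properties.CommutativeSemigroup +-commutativeSemigroup
  using (x∙yz≈y∙xz)
open import Algebra.Properties.Semiring.Sum +-*-semiring
  using ( sum-syntax; sum-cong-≗; sum-replicate-zero; ∑-distrib-+; ∑-comm
        ; *-distribˡ-sum; *-distribʳ-sum)
open import Data.Product.Base using (∃; Σ; _,_; _×_; proj₁; proj₂)
open import Data.Sum.Base using (_⊎_; inj₁; inj₂; [_,_]′)
open import Data.Unit.Base using (⊤; tt)
open import Data.Vec.Functional using (_∷_; tail)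
open import Function.Base using (_∘_)
open import Relation.Nullary.Decidable
  using ( Dec; yes; no; does; map′; _×-dec_; _⊎-dec_; _→-dec_; ¬?
        ; dec-true; dec-false; decidable-stable; ¬¬-excluded-middle)
open import Relation.Nullary.Negation using (¬_; contradiction; ¬¬-map)
open import Relation.Binary.PropositionalEquality
  using (_≡_; _≢_; _≗_; refl; sym; trans; subst; cong; cong₂; module ≡-Reasoning)
open import Relation.Binary.Construct.Closure.Transitive
  using (TransClosure; [_]; _++_)

+≢1ℙ⇒≡ : ∀ {p q} → p + q ≢ 1ℙ → p ≡ q
+≢1ℙ⇒≡ {0ℙ} {0ℙ} _     = refl
+≢1ℙ⇒≡ {0ℙ} {1ℙ} p+q≢1 = contradiction refl p+q≢1
+≢1ℙ⇒≡ {1ℙ} {0ℙ} p+q≢1 = contradiction refl p+q≢1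
+≢1ℙ⇒≡ {1ℙ} {1ℙ} _     = refl

parity-even : ∀ {m} → Even m → parity m ≡ 0ℙ
parity-even (divides q refl) = trans (*-homo-* q 2) (zeroʳ (parity q))

⟦_⟧ : ∀ {a} {A : Set a} → Dec A → Parity
⟦ a? ⟧ = if does a? then 1ℙ else 0ℙ

module _ {a} {A : Set a} (a? : Dec A) where

  ⟦⟧-yes : A → ⟦ a? ⟧ ≡ 1ℙ
  ⟦⟧-yes x = cong (if_then 1ℙ else 0ℙ) (dec-true a? x)

  ⟦⟧-no : ¬ A → ⟦ a? ⟧ ≡ 0ℙ
  ⟦⟧-no ¬x = cong (if_then 1ℙ else 0ℙ) (dec-false a? ¬x)

⟦⟧*-cong : ∀ {a} {A : Set a} (a? : Dec A) {p q} → (A → p ≡ q) → ⟦ a? ⟧ * p ≡ ⟦ a? ⟧ * q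
⟦⟧*-cong (yes x) p≡q = cong (1ℙ *_) (p≡q x)
⟦⟧*-cong (no _)  _   = refl

⟦⟧*≡1ℙ : ∀ {a} {A : Set a} (a? : Dec A) {p} → ⟦ a? ⟧ * p ≡ 1ℙ → A × p ≡ 1ℙ
⟦⟧*≡1ℙ (yes x) p≡1 = x , p≡1

⟦×-dec⟧ : ∀ {a b} {A : Set a} {B : Set b} (a? : Dec A) (b? : Dec B) →
          ⟦ a? ×-dec b? ⟧ ≡ ⟦ a? ⟧ * ⟦ b? ⟧
⟦×-dec⟧ (yes _) b? = refl
⟦×-dec⟧ (no _)  b? = refl

⟦×-dec⟧-implied : ∀ {a b} {A : Set a} {B : Set b} → (B → A) →
                  (a? : Dec A) (b? : Dec B) → ⟦ a? ×-dec b? ⟧ ≡ ⟦ b? ⟧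
⟦×-dec⟧-implied b⇒a (yes _)  b?      = refl
⟦×-dec⟧-implied b⇒a (no ¬a) (yes b) = contradiction (b⇒a b) ¬a
⟦×-dec⟧-implied b⇒a (no _)  (no _)  = refl

parity-count : ∀ {m} {P : Fin m → Set} (P? : ∀ i → Dec (P i)) →
               parity (count P?) ≡ ∑[ i < m ] ⟦ P? i ⟧
parity-count {zero}  P? = refl
parity-count {suc m} P? with P? zero
... | yes _ = trans (+-homo-+ 1 (count (P? ∘ suc))) (cong (1ℙ +_) (parity-count (P? ∘ suc)))
... | no  _ = parity-count (P? ∘ suc)

count-cong : ∀ {m} {P Q : Fin m → Set} (P? : ∀ i → Dec (P i)) (Q? : ∀ i → Dec (Q i)) →
             (∀ i → does (P? i) ≡ does (Q? i)) → count P? ≡ count Q?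
count-cong {zero}  P? Q? eq = refl
count-cong {suc m} P? Q? eq with P? zero | Q? zero | eq zero
... | yes _ | yes _ | _ = cong suc (count-cong (P? ∘ suc) (Q? ∘ suc) (eq ∘ suc))
... | no  _ | no  _ | _ = count-cong (P? ∘ suc) (Q? ∘ suc) (eq ∘ suc)

without : ∀ {m} {P : Fin m → Set} → (∀ i → Dec (P i)) → (a : Fin m) →
          ∀ i → Dec (P i × i ≢ a)
without P? a i = P? i ×-dec ¬? (i ≟ a)

count-without-suc : ∀ {m} {P : Fin (suc m) → Set} (P? : ∀ i → Dec (P i)) a →
                    count (without (P? ∘ suc) a) ≡ count (without P? (suc a) ∘ suc)
count-without-suc P? a =
  count-cong (without (P? ∘ suc) a) (without P? (suc a) ∘ suc) (λ _ → refl)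

count-remove : ∀ {m} {P : Fin m → Set} (P? : ∀ i → Dec (P i)) {a} → P a →
               count P? ≡ suc (count (without P? a))
count-remove {suc m} P? {zero} pa with P? zero
... | yes _  = cong suc (count-cong (P? ∘ suc) _ (λ i → sym (∧-identityʳ _)))
... | no ¬pa = contradiction pa ¬pa
count-remove {suc m} P? {suc a} pa with P? zero
... | yes _ = cong suc (trans (count-remove (P? ∘ suc) pa) (cong suc (count-without-suc P? a)))
... | no  _ = trans (count-remove (P? ∘ suc) pa) (cong suc (count-without-suc P? a))

count≡2⇒only : ∀ {m} {P : Fin m → Set} (P? : ∀ i → Dec (P i)) {a b c} →
               count P? ≡ 2 → P a → P b → a ≢ b → P c → c ≡ a ⊎ c ≡ b
count≡2⇒only P? {a} {b} {c} two pa pb a≢b pc with c ≟ a | c ≟ b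
... | yes c≡a | _       = inj₁ c≡a
... | no  _   | yes c≡b = inj₂ c≡b
... | no c≢a  | no c≢b  with () ← trans (sym two) (trans (count-remove P? pa)
        (cong suc (trans (count-remove (without P? a) (pb , a≢b ∘ sym))
        (cong suc (count-remove (without (without P? a) b) ((pc , c≢a) , c≢b))))))

∑-δ : ∀ {m} (a : Fin m) x → ∑[ i < m ] (⟦ i ≟ a ⟧ * x) ≡ x
∑-δ {suc m} zero    x = trans (cong (x +_) (sum-replicate-zero m)) (+-identityʳ x)
∑-δ {suc m} (suc a) x = ∑-δ a x

∑-pick : ∀ {m} (x : Fin m → Parity) a →
         ∑[ i < m ] x i ≡ x a + ∑[ i < m ] (⟦ ¬? (i ≟ a) ⟧ * x i)
∑-pick {suc m} x zero    = refl
∑-pick {suc m} x (suc a) =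
  trans (cong (x zero +_) (∑-pick (x ∘ suc) a)) (x∙yz≈y∙xz (x zero) (x (suc a)) _)

∑≡1ℙ⇒∃ : ∀ {m} (x : Fin m → Parity) → ∑[ i < m ] x i ≡ 1ℙ → ∃ λ i → x i ≡ 1ℙ
∑≡1ℙ⇒∃ {suc m} x ∑x≡1 with x zero in x₀≡
... | 1ℙ = zero , x₀≡
... | 0ℙ with i , xᵢ≡1 ← ∑≡1ℙ⇒∃ (x ∘ suc) ∑x≡1 = suc i , xᵢ≡1

∑≡0ℙ⇒another : ∀ {m} (x : Fin m → Parity) {a} → ∑[ i < m ] x i ≡ 0ℙ → x a ≡ 1ℙ →
               ∃ λ b → b ≢ a × x b ≡ 1ℙ
∑≡0ℙ⇒another {m} x {a} ∑x≡0 xₐ≡1 =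
  let i , term≡1 = ∑≡1ℙ⇒∃ _ others≡1 in i , ⟦⟧*≡1ℙ (¬? (i ≟ a)) term≡1
  where
  others : Parity
  others = ∑[ i < m ] (⟦ ¬? (i ≟ a) ⟧ * x i)
  others≡1 : others ≡ 1ℙ
  others≡1 = trans (+-cancelˡ-≡ (x a) _ _ xₐ+others≡xₐ+xₐ) xₐ≡1
    where
    xₐ+others≡xₐ+xₐ : x a + others ≡ x a + x a
    xₐ+others≡xₐ+xₐ = trans (sym (∑-pick x a)) (trans ∑x≡0 (sym (p+p≡0ℙ (x a))))

∑-over-two : ∀ {m} {P : Fin m → Set} (P? : ∀ i → Dec (P i)) {a b} →
             count P? ≡ 2 → P a → P b → a ≢ b →
             ∀ (g : Fin m → Parity) → ∑[ i < m ] (⟦ P? i ⟧ * g i) ≡ g a + g b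
∑-over-two {m} {P} P? {a} {b} two pa pb a≢b g = begin
    ∑[ i < m ] (⟦ P? i ⟧ * g i)
  ≡⟨ sum-cong-≗ {m} pointwise ⟩
    ∑[ i < m ] (⟦ i ≟ a ⟧ * g a + ⟦ i ≟ b ⟧ * g b)
  ≡⟨ ∑-distrib-+ (λ i → ⟦ i ≟ a ⟧ * g a) (λ i → ⟦ i ≟ b ⟧ * g b) ⟩
    ∑[ i < m ] (⟦ i ≟ a ⟧ * g a) + ∑[ i < m ] (⟦ i ≟ b ⟧ * g b)
  ≡⟨ cong₂ _+_ (∑-δ a (g a)) (∑-δ b (g b)) ⟩
    g a + g b
  ∎
  where
  open ≡-Reasoning
  neither : ∀ {i} → i ≢ a → i ≢ b → ¬ P i
  neither i≢a i≢b pᵢ = [ i≢a , i≢b ]′ (count≡2⇒only P? two pa pb a≢b pᵢ)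
  pointwise : ∀ i → ⟦ P? i ⟧ * g i ≡ ⟦ i ≟ a ⟧ * g a + ⟦ i ≟ b ⟧ * g b
  pointwise i with i ≟ a | i ≟ b
  ... | yes refl | yes refl = contradiction refl a≢b
  ... | yes refl | no _     rewrite ⟦⟧-yes (P? i) pa = sym (+-identityʳ (g i))
  ... | no _     | yes refl rewrite ⟦⟧-yes (P? i) pb = refl
  ... | no i≢a   | no i≢b   rewrite ⟦⟧-no (P? i) (neither i≢a i≢b) = refl

∑-*-∑ : ∀ {m p} (a : Fin m → Parity) (b : Fin m → Fin p → Parity) (g : Fin p → Parity) →
        ∑[ i < m ] (a i * ∑[ j < p ] (b i j * g j)) ≡
        ∑[ j < p ] (∑[ i < m ] (a i * b i j) * g j)
∑-*-∑ {m} {p} a b g = begin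
    ∑[ i < m ] (a i * ∑[ j < p ] (b i j * g j))
  ≡⟨ sum-cong-≗ {m} (λ i → *-distribˡ-sum (a i) (λ j → b i j * g j)) ⟩
    ∑[ i < m ] ∑[ j < p ] (a i * (b i j * g j))
  ≡⟨ ∑-comm (λ i j → a i * (b i j * g j)) ⟩
    ∑[ j < p ] ∑[ i < m ] (a i * (b i j * g j))
  ≡⟨ sum-cong-≗ {p} (λ j → sum-cong-≗ {m} (λ i → *-assoc (a i) (b i j) (g j))) ⟨
    ∑[ j < p ] ∑[ i < m ] (a i * b i j * g j)
  ≡⟨ sum-cong-≗ {p} (λ j → *-distribʳ-sum (g j) (λ i → a i * b i j)) ⟨
    ∑[ j < p ] (∑[ i < m ] (a i * b i j) * g j)
  ∎
  where open ≡-Reasoning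

¬¬-∀-Fin : ∀ {m} {P : Fin m → Set} → (∀ i → ¬ ¬ P i) → ¬ ¬ (∀ i → P i)
¬¬-∀-Fin {zero}  _   ¬∀ = ¬∀ λ ()
¬¬-∀-Fin {suc m} ¬¬P ¬∀ = ¬¬P zero λ p₀ → ¬¬-∀-Fin (¬¬P ∘ suc) λ pₛ → ¬∀ (∀-cons p₀ pₛ)

any-vector? : ∀ {n} {P : (Fin n → Parity) → Set} → (∀ g → Dec (P g)) →
              (∀ {g h} → g ≗ h → P g → P h) → Dec (∃ P)
any-vector? {zero}  P? resp = map′ (_ ,_) (λ (g , pg) → resp (λ ()) pg) (P? (λ ()))
any-vector? {suc n} {P} P? resp =
  map′ [ cons 0ℙ , cons 1ℙ ]′ split (with-head 0ℙ ⊎-dec with-head 1ℙ)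
  where
  cons : ∀ p → (∃ λ g → P (p ∷ g)) → ∃ P
  cons p (g , pg) = p ∷ g , pg
  with-head : ∀ p → Dec (∃ λ g → P (p ∷ g))
  with-head p = any-vector? (P? ∘ (p ∷_)) λ g≗h → resp (∀-cons refl g≗h)
  split : ∃ P → (∃ λ g → P (0ℙ ∷ g)) ⊎ (∃ λ g → P (1ℙ ∷ g))
  split (g , pg) = by-head (g zero) (resp (∀-cons refl λ _ → refl) pg)
    where
    by-head : ∀ p → P (p ∷ tail g) → (∃ λ g → P (0ℙ ∷ g)) ⊎ (∃ λ g → P (1ℙ ∷ g))
    by-head 0ℙ p = inj₁ (tail g , p)
    by-head 1ℙ p = inj₂ (tail g , p)

module AcyclicRelation {n} (R : Fin n → Fin n → Set)
                       (acyclic : ∀ y → ¬ TransClosure R y y) where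

  Chain : ℕ → Fin n → Set
  Chain zero    y = ⊤
  Chain (suc m) y = ∃ λ y′ → R y′ y × Chain m y′

  element : ∀ {m y} → Chain m y → Fin (suc m) → Fin n
  element {y = y} _           zero    = y
  element {suc m} (_ , _ , c) (suc i) = element c i

  path-to-end : ∀ {m y} (c : Chain m y) j → TransClosure R (element c (suc j)) y
  path-to-end {suc m} (_ , r , c) zero    = [ r ]
  path-to-end {suc m} (_ , r , c) (suc j) = path-to-end c j ++ [ r ]

  path : ∀ {m y} (c : Chain m y) {i j} → i < j → TransClosure R (element c j) (element c i)
  path         c           {zero}  {suc j} _         = path-to-end c j
  path {suc m} (_ , _ , c) {suc i} {suc j} (s≤s i<j) = path c i<j

  no-chain-of-length-n : ∀ y → ¬ Chain n y
  no-chain-of-length-n y c with i , j , i<j , cᵢ≡cⱼ ← pigeonhole (n<1+n n) (element c) =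
    acyclic (element c i)
            (subst (λ x → TransClosure R x (element c i)) (sym cᵢ≡cⱼ) (path c i<j))

  no-descending-set : (D : Fin n → Set) → (∀ y → D y → ∃ λ y′ → D y′ × R y′ y) →
                      ∀ y → ¬ D y
  no-descending-set D descend y dy = no-chain-of-length-n y (chain n y dy)
    where
    chain : ∀ m y → D y → Chain m y
    chain zero    y _  = tt
    chain (suc m) y dy with y′ , dy′ , r ← descend y dy = y′ , r , chain m y′ dy′

  module Fixpoint {A : Set} (F : (Fin n → A) → Fin n → A)
                  (F-local : ∀ {g h} t → (∀ t′ → R t′ t → g t′ ≡ h t′) → F g t ≡ F h t)
                  (g₀ : Fin n → A) where

    approx : ℕ → Fin n → A
    approx zero    = g₀
    approx (suc m) = F (approx m)

    approx-stable : ∀ m t → ¬ Chain m t → approx m t ≡ approx (suc m) t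
    approx-stable zero    t no-chain = contradiction tt no-chain
    approx-stable (suc m) t no-chain =
      F-local t (λ t′ r → approx-stable m t′ (λ c → no-chain (t′ , r , c)))

    fix : Fin n → A
    fix = approx n

    fix-unfold : ∀ t → fix t ≡ F fix t
    fix-unfold t = approx-stable n t (no-chain-of-length-n t)

module Boundary (S : FinPoset) where
  open FinPoset S using (n; _⋖_; _⋖?_)

  ∂ : (Fin n → Parity) → Fin n → Parity
  ∂ g x = ∑[ y < n ] (⟦ x ⋖? y ⟧ * g y)

  ∂-cong : ∀ {g h} → g ≗ h → ∂ g ≗ ∂ h
  ∂-cong g≗h x = sum-cong-≗ {n} (λ y → cong (⟦ x ⋖? y ⟧ *_) (g≗h y))

  ∂-+ : ∀ g h x → ∂ (λ y → g y + h y) x ≡ ∂ g x + ∂ h x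
  ∂-+ g h x = trans (sum-cong-≗ {n} (λ y → distribˡ ⟦ x ⋖? y ⟧ (g y) (h y)))
                    (∑-distrib-+ (λ y → ⟦ x ⋖? y ⟧ * g y) (λ y → ⟦ x ⋖? y ⟧ * h y))

  ∂1≡parity-upDegree : ∀ x → ∂ (λ _ → 1ℙ) x ≡ parity (upDegree S x)
  ∂1≡parity-upDegree x =
    trans (sum-cong-≗ {n} (λ y → *-identityʳ ⟦ x ⋖? y ⟧)) (sym (parity-count (x ⋖?_)))

  module Ranked {rk : Fin n → ℕ} (ranked : IsRankFunction S rk) (k′ : ℕ)
    (even-between : ∀ y z → rk y ≡ suc (suc k′) → rk z ≡ k′ →
                    Even (between S rk (suc (suc k′)) z y))
    where
    open IsRankFunction ranked

    rank-above : ∀ {x y m} → x ⋖ y → rk x ≡ m → rk y ≡ suc m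
    rank-above x⋖y rk-x = trans (coverStep x⋖y) (cong suc rk-x)

    rank-below : ∀ {x y m} → x ⋖ y → rk y ≡ suc m → rk x ≡ m
    rank-below x⋖y rk-y = suc-injective (trans (sym (coverStep x⋖y)) rk-y)

    ∂∂≡0 : ∀ g r → rk r ≡ k′ → ∂ (∂ g) r ≡ 0ℙ
    ∂∂≡0 g r rk-r = begin
        ∂ (∂ g) r
      ≡⟨ ∑-*-∑ (λ f → ⟦ r ⋖? f ⟧) (λ f t → ⟦ f ⋖? t ⟧) g ⟩
        ∑[ t < n ] (∑[ f < n ] (⟦ r ⋖? f ⟧ * ⟦ f ⋖? t ⟧) * g t)
      ≡⟨ sum-cong-≗ {n} (λ t → cong (_* g t) (paths-even t)) ⟩
        ∑[ t < n ] 0ℙ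
      ≡⟨ sum-replicate-zero n ⟩
        0ℙ
      ∎
      where
      open ≡-Reasoning
      rank-between : ∀ {f t} → r ⋖ f × f ⋖ t → rk f ≡ suc k′ × rk t ≡ suc (suc k′)
      rank-between (r⋖f , f⋖t) = rank-above r⋖f rk-r , rank-above f⋖t (rank-above r⋖f rk-r)

      paths-even : ∀ t → ∑[ f < n ] (⟦ r ⋖? f ⟧ * ⟦ f ⋖? t ⟧) ≡ 0ℙ
      paths-even t with rk t ≟ℕ suc (suc k′)
      ... | yes rk-t = begin
          ∑[ f < n ] (⟦ r ⋖? f ⟧ * ⟦ f ⋖? t ⟧)
        ≡⟨ sum-cong-≗ {n} as-between ⟩
          ∑[ f < n ] ⟦ between? f ⟧
        ≡⟨ parity-count between? ⟨
          parity (between S rk (suc (suc k′)) r t)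
        ≡⟨ parity-even (even-between t r rk-t rk-r) ⟩
          0ℙ
        ∎
        where
        between? : ∀ f → Dec (rk f ≡ suc k′ × r ⋖ f × f ⋖ t)
        between? f = (rk f ≟ℕ suc k′) ×-dec ((r ⋖? f) ×-dec (f ⋖? t))
        as-between : ∀ f → ⟦ r ⋖? f ⟧ * ⟦ f ⋖? t ⟧ ≡ ⟦ between? f ⟧
        as-between f = sym (trans
          (⟦×-dec⟧-implied (proj₁ ∘ rank-between) (rk f ≟ℕ suc k′) ((r ⋖? f) ×-dec (f ⋖? t)))
          (⟦×-dec⟧ (r ⋖? f) (f ⋖? t)))
      ... | no ¬rk-t = trans (sum-cong-≗ {n} no-path) (sum-replicate-zero n)
        where
        no-path : ∀ f → ⟦ r ⋖? f ⟧ * ⟦ f ⋖? t ⟧ ≡ 0ℙ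
        no-path f = trans (sym (⟦×-dec⟧ (r ⋖? f) (f ⋖? t)))
                          (⟦⟧-no ((r ⋖? f) ×-dec (f ⋖? t)) (¬rk-t ∘ proj₂ ∘ rank-between))

    IsBoundary : (Fin n → Parity) → Set
    IsBoundary c = ∃ λ ψ → ∀ f → rk f ≡ suc k′ → ∂ ψ f ≡ c f

    isBoundary? : ∀ c → Dec (IsBoundary c)
    isBoundary? c =
      any-vector? (λ ψ → all? λ f → (rk f ≟ℕ suc k′) →-dec (∂ ψ f ≟ℙ c f))
                  (λ ψ≗φ ∂ψ≡c f rk-f → trans (sym (∂-cong ψ≗φ f)) (∂ψ≡c f rk-f))

    module DecidableMatching {M : Fin n → Fin n → Set} (matching : IsMatching S M)
                             (M? : ∀ x y → Dec (M x y)) (acyclic : Acyclic S M)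
                             (no-critical : ∀ x → rk x ≡ suc k′ → ¬ Critical S M x)
                             (c : Fin n → Parity) (c-cycle : ∀ r → rk r ≡ k′ → ∂ c r ≡ 0ℙ)
                             where
      open IsMatching matching
      open AcyclicRelation (MStep S M) acyclic

      ∂-except : Fin n → (Fin n → Parity) → Fin n → Parity
      ∂-except t g f = ∑[ y < n ] (⟦ ¬? (y ≟ t) ⟧ * (⟦ f ⋖? y ⟧ * g y))

      -- At a t matched with f below it, the value forced by ∂ g f = c f.
      extend : (Fin n → Parity) → Fin n → Parity
      extend g t with any? (λ f → M? f t)
      ... | yes (f , _) = c f + ∂-except t g f
      ... | no  _       = 0ℙ

      extend-local : ∀ {g h} t → (∀ t′ → MStep S M t′ t → g t′ ≡ h t′) →
                     extend g t ≡ extend h t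
      extend-local {g} {h} t agree with any? (λ f → M? f t)
      ... | yes (f , Mft) = cong (c f +_) (sum-cong-≗ {n} λ y →
        ⟦⟧*-cong (¬? (y ≟ t)) λ y≢t → ⟦⟧*-cong (f ⋖? y) λ f⋖y → agree y (f , Mft , f⋖y , y≢t))
      ... | no _ = refl

      extend-matched : ∀ g {f t} → M f t → extend g t ≡ c f + ∂-except t g f
      extend-matched g {f} {t} Mft with any? (λ f → M? f t)
      ... | yes (f′ , Mf′t) with refl ← uniq-top Mft Mf′t = refl
      ... | no unmatched = contradiction (f , Mft) unmatched

      open Fixpoint extend extend-local (λ _ → 0ℙ)

      ∂fix-matched : ∀ {f t} → M f t → ∂ fix f ≡ c f
      ∂fix-matched {f} {t} Mft = begin
          ∂ fix f
        ≡⟨ ∑-pick (λ y → ⟦ f ⋖? y ⟧ * fix y) t ⟩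
          ⟦ f ⋖? t ⟧ * fix t + rest
        ≡⟨ cong (λ p → p * fix t + rest) (⟦⟧-yes (f ⋖? t) (covers Mft)) ⟩
          fix t + rest
        ≡⟨ cong (_+ rest) (trans (fix-unfold t) (extend-matched fix Mft)) ⟩
          c f + rest + rest
        ≡⟨ +-assoc (c f) rest rest ⟩
          c f + (rest + rest)
        ≡⟨ cong (c f +_) (p+p≡0ℙ rest) ⟩
          c f + 0ℙ
        ≡⟨ +-identityʳ (c f) ⟩
          c f
        ∎
        where
        open ≡-Reasoning
        rest : Parity
        rest = ∂-except t fix f

      defect : Fin n → Parity
      defect f = c f + ∂ fix f

      Bad : Fin n → Set
      Bad f = rk f ≡ suc k′ × defect f ≡ 1ℙ

      ∂defect≡0 : ∀ r → rk r ≡ k′ → ∂ defect r ≡ 0ℙ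
      ∂defect≡0 r rk-r =
        trans (∂-+ c (∂ fix) r) (cong₂ _+_ (c-cycle r rk-r) (∂∂≡0 fix r rk-r))

      bad-matched-below : ∀ {f} → Bad f → ∃ λ r → M r f
      bad-matched-below {f} (rk-f , defect≡1) with any? (λ r → M? r f)
      ... | yes matched = matched
      ... | no unmatched = contradiction (unmatched-above , unmatched) (no-critical f rk-f)
        where
        unmatched-above : ¬ ∃ λ t → M f t
        unmatched-above (t , Mft) with () ← trans (sym defect≡1)
          (trans (cong (c f +_) (∂fix-matched Mft)) (p+p≡0ℙ (c f)))

      bad-descends : ∀ f → Bad f → ∃ λ f′ → Bad f′ × MStep S M f′ f
      bad-descends f bad@(rk-f , defect≡1)
        with r , Mrf ← bad-matched-below bad
        with rk-r ← rank-below (covers Mrf) rk-f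
        with f′ , f′≢f , term≡1 ← ∑≡0ℙ⇒another (λ f′ → ⟦ r ⋖? f′ ⟧ * defect f′)
               (∂defect≡0 r rk-r)
               (trans (cong (_* defect f) (⟦⟧-yes (r ⋖? f) (covers Mrf))) defect≡1)
        with r⋖f′ , defect′≡1 ← ⟦⟧*≡1ℙ (r ⋖? f′) term≡1
        = f′ , (rank-above r⋖f′ rk-r , defect′≡1) , r , Mrf , r⋖f′ , f′≢f

      ∂fix≡c : ∀ f → rk f ≡ suc k′ → ∂ fix f ≡ c f
      ∂fix≡c f rk-f =
        sym (+≢1ℙ⇒≡ λ defect≡1 → no-descending-set Bad bad-descends f (rk-f , defect≡1))

      isBoundary : IsBoundary c
      isBoundary = fix , ∂fix≡c

    -- M need not be decidable, but the conclusion is, so it may be assumed under ¬¬.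
    cycle-is-boundary : ∀ {M} → IsMatching S M → Acyclic S M →
                        (∀ x → rk x ≡ suc k′ → ¬ Critical S M x) →
                        ∀ c → (∀ r → rk r ≡ k′ → ∂ c r ≡ 0ℙ) → IsBoundary c
    cycle-is-boundary {M} matching acyclic no-critical c c-cycle =
      decidable-stable (isBoundary? c) (¬¬-map boundary M-decidable)
      where
      M-decidable : ¬ ¬ (∀ x y → Dec (M x y))
      M-decidable = ¬¬-∀-Fin λ x → ¬¬-∀-Fin λ y → ¬¬-excluded-middle
      boundary : (∀ x y → Dec (M x y)) → IsBoundary c
      boundary M? = DecidableMatching.isBoundary matching M? acyclic no-critical c c-cycle

    adjacent-differ : (∀ x → rk x ≡ suc k′ → upDegree S x ≡ 2) →
                      ∀ ψ → (∀ f → rk f ≡ suc k′ → ∂ ψ f ≡ 1ℙ) →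
                      ∀ {x₁ x₂} → rk x₁ ≡ suc (suc k′) → Adjacent S x₁ x₂ → ψ x₁ ≢ ψ x₂
    adjacent-differ two-covers ψ ∂ψ≡1 {x₁} {x₂} rk-x₁ (x₁≢x₂ , z , z⋖x₁ , z⋖x₂) ψx₁≡ψx₂ =
      p≢p⁻¹ 0ℙ (trans (sym (p+p≡0ℙ (ψ x₁))) (trans (cong (ψ x₁ +_) ψx₁≡ψx₂) ψx₁+ψx₂≡1))
      where
      rk-z : rk z ≡ suc k′
      rk-z = rank-below z⋖x₁ rk-x₁
      ψx₁+ψx₂≡1 : ψ x₁ + ψ x₂ ≡ 1ℙ
      ψx₁+ψx₂≡1 = trans (sym (∑-over-two (z ⋖?_) (two-covers z rk-z) z⋖x₁ z⋖x₂ x₁≢x₂ ψ))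
                        (∂ψ≡1 z rk-z)

fromParity : Parity → Fin 2
fromParity 0ℙ = zero
fromParity 1ℙ = suc zero

fromParity-injective : ∀ {p q} → fromParity p ≡ fromParity q → p ≡ q
fromParity-injective {0ℙ} {0ℙ} _ = refl
fromParity-injective {1ℙ} {1ℙ} _ = refl

theorem1p4 : (S : FinPoset) (rk : Fin (FinPoset.n S) → ℕ) (k : ℕ)
    → SphereLike S rk k
    → (∀ z → rk z ≡ k ∸ 2 → Even (upDegree S z))
    → ∃ λ (ψ : Σ (Fin (FinPoset.n S)) (λ x → rk x ≡ k) → Fin 2)
    → ∀ x₁ x₂ (h₁ : rk x₁ ≡ k) (h₂ : rk x₂ ≡ k)
    → Adjacent S x₁ x₂ → ¬ (ψ (x₁ , h₁) ≡ ψ (x₂ , h₂))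
theorem1p4 S rk zero           sphere _ with () ← SphereLike.k≥2 sphere
theorem1p4 S rk (suc zero)     sphere _ with s≤s () ← SphereLike.k≥2 sphere
theorem1p4 S rk (suc (suc k′)) sphere even-up =
  fromParity ∘ ψ ∘ proj₁ ,
  λ x₁ x₂ rk-x₁ _ adj → adjacent-differ cond-i ψ ∂ψ≡1 rk-x₁ adj ∘ fromParity-injective
  where
  open SphereLike sphere
  open Boundary S
  open Ranked ranked k′ cond-ii

  all-ones-is-boundary : IsBoundary (λ _ → 1ℙ)
  all-ones-is-boundary =
    let M , matching , acyclic , no-critical = cond-iii
    in cycle-is-boundary matching acyclic no-critical (λ _ → 1ℙ)
         (λ r rk-r → trans (∂1≡parity-upDegree r) (parity-even (even-up r rk-r)))

  ψ : Fin (FinPoset.n S) → Parity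
  ψ = proj₁ all-ones-is-boundary

  ∂ψ≡1 : ∀ f → rk f ≡ suc k′ → ∂ ψ f ≡ 1ℙ
  ∂ψ≡1 = proj₂ all-ones-is-boundary
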